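{- Let $P$ be a finite ranked poset with a unique minimal element $\hat{0}$, and let $\sim$ be an equivalence relation on $P$ such that $P/\sim$ is a homogeneous quotient. Suppose that for every equivalence class $X\neq\{\hat{0}\}$, $\sum_{y\in L(X)}\mu(y)=0$, where $L(X)$ is the lower order ideal of $P$ generated by $X$, and that $x\sim y$ implies $\rho(x)=\rho(y)$. Then $\chi(P/\sim,t)=\chi(P,t)$.
   Context: The Möbius function of a finite poset $Q$ with minimum $\hat{0}$ is defined by $\sum_{y\leq x}\mu(y)=\delta_{\hat{0},x}$. A poset is ranked if all saturated $\hat{0}$--$x$ chains have the same length $\rho(x)$; $\rho(Q)=\max_x\rho(x)$. The characteristic polynomial of a ranked poset $Q$ is $\chi(Q,t)=\sum_{x\in Q}\mu(x)t^{\rho(Q)-\rho(x)}$. For an equivalence relation $\sim$ on $P$, the quotient $P/\sim$ is the set of equivalence classes with $X\leq Y$ iff $x\leq y$ in $P$ for some $x\in X$, $y\in Y$; it is a homogeneous quotient if (1) $\{\hat{0}\}$ is an equivalence class, and (2) whenever $X\leq Y$, for every $x\in X$ there is $y\in Y$ with $x\leq y$ (then $P/\sim$ is a poset). -}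

module Defs where

open import Data.Nat using (ℕ; zero; suc; _∸_; _⊔_)
open import Data.Integer using (ℤ; 0ℤ; 1ℤ; _+_)
open import Data.Fin using (Fin)
import Data.Fin as F
open import Data.Fin.Properties using (any?)
open import Data.Product using (Σ; ∃; ∃₂; _×_; _,_)
open import Data.Bool using (if_then_else_)
open import Relation.Nullary using (¬_; Dec; yes; no)
open import Relation.Nullary.Decidable using (⌊_⌋; _×-dec_)
open import Relation.Binary using (Decidable)
open import Relation.Binary.PropositionalEquality using (_≡_; _≢_)
import Data.Nat as N

∑ : ∀ {n} → (Fin n → ℤ) → ℤ
∑ {zero}  f = 0ℤ
∑ {suc n} f = f F.zero + ∑ (λ i → f (F.suc i))

maxF : ∀ {n} → (Fin n → ℕ) → ℕ
maxF {zero}  f = 0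
maxF {suc n} f = f F.zero ⊔ maxF (λ i → f (F.suc i))

module OnFin {n : ℕ} (_≤_ : Fin n → Fin n → Set) (_≤?_ : Decidable _≤_) where

  IsMobius : Fin n → (Fin n → ℤ) → Set
  IsMobius z μ = ∀ x → ∑ (λ y → if ⌊ y ≤? x ⌋ then μ y else 0ℤ)
                        ≡ (if ⌊ z F.≟ x ⌋ then 1ℤ else 0ℤ)

  _<_ : Fin n → Fin n → Set
  x < y = x ≤ y × x ≢ y

  _⋖_ : Fin n → Fin n → Set
  x ⋖ y = x < y × (∀ z → ¬ (x < z × z < y))

  data SatChain : Fin n → Fin n → ℕ → Set where
    done : ∀ {a} → SatChain a a 0
    step : ∀ {a b c k} → a ⋖ b → SatChain b c k → SatChain a c (suc k)

  -- ρ is a rank function w.r.t. the minimum z: every saturated z–x chain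
  -- has length ρ x.  (The poset is ranked iff such a ρ exists.)
  IsRankFn : Fin n → (Fin n → ℕ) → Set
  IsRankFn z ρ = ∀ x k → SatChain z x k → k ≡ ρ x

  rankOf : (Fin n → ℕ) → ℕ
  rankOf ρ = maxF ρ

  -- Coefficient of t^k in χ(Q,t) = Σ_x μ(x) t^{ρ(Q) - ρ(x)}.
  χcoeff : (Fin n → ℕ) → (Fin n → ℤ) → ℕ → ℤ
  χcoeff ρ μ k = ∑ (λ x → if ⌊ (rankOf ρ ∸ ρ x) N.≟ k ⌋ then μ x else 0ℤ)

-- The order on the quotient P/∼, where the classes are encoded as Fin m
-- via the class map π : X ≤ Y iff x ≤ y for some x ∈ X, y ∈ Y.
module Quot {n m : ℕ} (_≤_ : Fin n → Fin n → Set) (_≤?_ : Decidable _≤_)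
            (π : Fin n → Fin m) where

  _≤Q_ : Fin m → Fin m → Set
  X ≤Q Y = ∃₂ λ x y → π x ≡ X × π y ≡ Y × x ≤ y

  _≤Q?_ : Decidable _≤Q_
  X ≤Q? Y with any? (λ x → any? (λ y → (π x F.≟ X) ×-dec ((π y F.≟ Y) ×-dec (x ≤? y))))
  ... | yes (x , y , p) = yes (x , y , p)
  ... | no ¬p = no (λ { (x , y , p) → ¬p (x , y , p) })

  InL : Fin m → Fin n → Set
  InL X y = ∃ λ x → π x ≡ X × y ≤ x

  InL? : ∀ X y → Dec (InL X y)
  InL? X y = any? (λ x → (π x F.≟ X) ×-dec (y ≤? x))

-- Every class of P/∼ is ranked by the common rank of its elements: coverings of P
-- map to coverings of P/∼, and by homogeneity a covering X ⋖ Y of P/∼ lifts to a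
-- saturated chain of P from any x ∈ X into Y, which cannot pass through a third class,
-- so it is a single covering.  Thus P/∼ is ranked with the same rank function.
-- Grouping μ by classes gives ν(X) = Σ_{x ∈ X} μ(x), and Σ_{Y ≤ X} ν(Y) equals
-- Σ_{y ∈ L(X)} μ(y) by homogeneity; the hypothesis makes these vanish for X ≠ {0̂},
-- so ν is the Möbius function of P/∼.  Regrouping χ(P,t) by classes gives χ(P/∼,t).

module Submission where

open import Defs
open import Data.Nat using (ℕ; zero; suc; _+_; _∸_; z≤n)
import Data.Nat as ℕ
import Data.Nat.Properties as ℕₚ
open import Data.Nat.Induction using (<-wellFounded)
open import Data.Integer using (ℤ; 0ℤ; 1ℤ)
import Data.Integer as ℤ
import Data.Integer.Properties as ℤ
open import Data.Fin using (Fin; zero; suc; _≟_)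
open import Data.Fin.Properties using (any?; suc-injective)
open import Data.Fin.Induction using (po-noetherian; po-wellFounded)
open import Data.Bool using (Bool; true; false; if_then_else_)
open import Data.Product using (∃; _×_; _,_; proj₁; proj₂)
open import Data.Empty using (⊥-elim)
open import Function using (_∘_; _⇔_; mk⇔; Equivalence)
open import Induction.WellFounded using (Acc; acc)
open import Relation.Nullary using (Dec; yes; no)
open import Relation.Nullary.Decidable using (⌊_⌋; _×-dec_; ¬?; isYes≗does; dec-true; does-⇔)
open import Relation.Binary using (Decidable; Reflexive; IsPartialOrder; IsEquivalence)
open import Relation.Binary.PropositionalEquality
  using (_≡_; _≢_; refl; sym; trans; cong; cong₂; subst; module ≡-Reasoning)
open import Algebra.Bundles using (AbelianGroup)
import Algebra.Properties.CommutativeMonoid.Sum ℤ.+-0-commutativeMonoid as Sum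
open Sum using (sum; sum-replicate-zero)
open import Algebra.Properties.Group (AbelianGroup.group ℤ.+-0-abelianGroup)
  using (∙-cancelʳ)

⌊⌋-⇔ : ∀ {a b} {A : Set a} {B : Set b} → A ⇔ B → (a? : Dec A) (b? : Dec B) → ⌊ a? ⌋ ≡ ⌊ b? ⌋
⌊⌋-⇔ A⇔B a? b? = trans (isYes≗does a?) (trans (does-⇔ A⇔B a? b?) (sym (isYes≗does b?)))

⌊⌋-true : ∀ {a} {A : Set a} (a? : Dec A) → A → ⌊ a? ⌋ ≡ true
⌊⌋-true a? a = trans (isYes≗does a?) (dec-true a? a)

if-⇔ : ∀ {a b} {A : Set a} {B : Set b} → A ⇔ B → (a? : Dec A) (b? : Dec B) {u v : ℤ} →
       (if ⌊ a? ⌋ then u else v) ≡ (if ⌊ b? ⌋ then u else v)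
if-⇔ A⇔B a? b? = cong (if_then _ else _) (⌊⌋-⇔ A⇔B a? b?)

if-true : ∀ {a} {A : Set a} (a? : Dec A) → A → {u v : ℤ} → (if ⌊ a? ⌋ then u else v) ≡ u
if-true a? a = cong (if_then _ else _) (⌊⌋-true a? a)

∑≡sum : ∀ {n} (f : Fin n → ℤ) → ∑ f ≡ sum f
∑≡sum {zero}  f = refl
∑≡sum {suc n} f = cong (ℤ._+_ (f zero)) (∑≡sum (f ∘ suc))

∑-cong : ∀ {n} {f g : Fin n → ℤ} → (∀ i → f i ≡ g i) → ∑ f ≡ ∑ g
∑-cong {zero}  e = refl
∑-cong {suc n} e = cong₂ ℤ._+_ (e zero) (∑-cong (e ∘ suc))

∑-zero : ∀ {n} → ∑ {n} (λ _ → 0ℤ) ≡ 0ℤ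
∑-zero {n} = trans (∑≡sum {n} (λ _ → 0ℤ)) (sum-replicate-zero n)

∑-distrib-+ : ∀ {n} (f g : Fin n → ℤ) → ∑ (λ i → f i ℤ.+ g i) ≡ ∑ f ℤ.+ ∑ g
∑-distrib-+ f g = begin
  ∑ (λ i → f i ℤ.+ g i)   ≡⟨ ∑≡sum (λ i → f i ℤ.+ g i) ⟩
  sum (λ i → f i ℤ.+ g i) ≡⟨ Sum.∑-distrib-+ f g ⟩
  sum f ℤ.+ sum g         ≡⟨ sym (cong₂ ℤ._+_ (∑≡sum f) (∑≡sum g)) ⟩
  ∑ f ℤ.+ ∑ g             ∎
  where open ≡-Reasoning

∑-comm : ∀ {m n} (f : Fin m → Fin n → ℤ) → ∑ (λ i → ∑ (f i)) ≡ ∑ (λ j → ∑ (λ i → f i j))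
∑-comm f = begin
  ∑ (λ i → ∑ (f i))             ≡⟨ trans (∑≡sum (λ i → ∑ (f i))) (Sum.sum-cong-≗ (∑≡sum ∘ f)) ⟩
  sum (λ i → sum (f i))         ≡⟨ Sum.∑-comm f ⟩
  sum (λ j → sum (λ i → f i j)) ≡⟨ sym (trans (∑≡sum (λ j → ∑ (λ i → f i j))) (Sum.sum-cong-≗ (λ j → ∑≡sum (λ i → f i j)))) ⟩
  ∑ (λ j → ∑ (λ i → f i j))     ∎
  where open ≡-Reasoning

∑-indicator : ∀ {n} (j : Fin n) (g : Fin n → ℤ) → ∑ (λ i → if ⌊ j ≟ i ⌋ then g i else 0ℤ) ≡ g j
∑-indicator {suc n} zero    g = trans (cong (ℤ._+_ (g zero)) (∑-zero {n})) (ℤ.+-identityʳ (g zero))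
∑-indicator {suc n} (suc j) g = begin
  0ℤ ℤ.+ ∑ (λ i → if ⌊ suc j ≟ suc i ⌋ then g (suc i) else 0ℤ)
    ≡⟨ ℤ.+-identityˡ _ ⟩
  ∑ (λ i → if ⌊ suc j ≟ suc i ⌋ then g (suc i) else 0ℤ)
    ≡⟨ ∑-cong (λ i → if-⇔ (mk⇔ suc-injective (cong suc)) (suc j ≟ suc i) (j ≟ i)) ⟩
  ∑ (λ i → if ⌊ j ≟ i ⌋ then g (suc i) else 0ℤ)
    ≡⟨ ∑-indicator j (g ∘ suc) ⟩
  g (suc j) ∎
  where open ≡-Reasoning

∑-split : ∀ {n} (j : Fin n) (g : Fin n → ℤ) → ∑ g ≡ g j ℤ.+ ∑ (λ i → if ⌊ j ≟ i ⌋ then 0ℤ else g i)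
∑-split j g = begin
  ∑ g                                               ≡⟨ ∑-cong split ⟩
  ∑ (λ i → on i ℤ.+ off i)                          ≡⟨ ∑-distrib-+ on off ⟩
  ∑ on ℤ.+ ∑ off                                    ≡⟨ cong (ℤ._+ ∑ off) (∑-indicator j g) ⟩
  g j ℤ.+ ∑ off                                     ∎
  where
  open ≡-Reasoning
  on off : Fin _ → ℤ
  on  i = if ⌊ j ≟ i ⌋ then g i else 0ℤ
  off i = if ⌊ j ≟ i ⌋ then 0ℤ else g i
  split : ∀ i → g i ≡ on i ℤ.+ off i
  split i with ⌊ j ≟ i ⌋
  ... | true  = sym (ℤ.+-identityʳ (g i))
  ... | false = sym (ℤ.+-identityˡ (g i))

∑-if : ∀ {n} (b : Bool) (f : Fin n → ℤ) → (if b then ∑ f else 0ℤ) ≡ ∑ (λ i → if b then f i else 0ℤ)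
∑-if         true  f = refl
∑-if {n} false f = sym (∑-zero {n})

pushforward : ∀ {n m} → (Fin n → Fin m) → (Fin n → ℤ) → Fin m → ℤ
pushforward π μ X = ∑ (λ x → if ⌊ π x ≟ X ⌋ then μ x else 0ℤ)

∑-pushforward : ∀ {n m} (π : Fin n → Fin m) (μ : Fin n → ℤ) (b : Fin m → Bool) →
                ∑ (λ X → if b X then pushforward π μ X else 0ℤ) ≡ ∑ (λ x → if b (π x) then μ x else 0ℤ)
∑-pushforward π μ b = begin
  ∑ (λ X → if b X then pushforward π μ X else 0ℤ)
    ≡⟨ ∑-cong (λ X → ∑-if (b X) (λ x → if ⌊ π x ≟ X ⌋ then μ x else 0ℤ)) ⟩
  ∑ (λ X → ∑ (λ x → if b X then (if ⌊ π x ≟ X ⌋ then μ x else 0ℤ) else 0ℤ))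
    ≡⟨ ∑-comm (λ X x → if b X then (if ⌊ π x ≟ X ⌋ then μ x else 0ℤ) else 0ℤ) ⟩
  ∑ (λ x → ∑ (λ X → if b X then (if ⌊ π x ≟ X ⌋ then μ x else 0ℤ) else 0ℤ))
    ≡⟨ ∑-cong (λ x → ∑-cong (λ X → if-swap (b X) ⌊ π x ≟ X ⌋)) ⟩
  ∑ (λ x → ∑ (λ X → if ⌊ π x ≟ X ⌋ then (if b X then μ x else 0ℤ) else 0ℤ))
    ≡⟨ ∑-cong (λ x → ∑-indicator (π x) (λ X → if b X then μ x else 0ℤ)) ⟩
  ∑ (λ x → if b (π x) then μ x else 0ℤ) ∎
  where
  open ≡-Reasoning
  if-swap : ∀ c d {v : ℤ} → (if c then (if d then v else 0ℤ) else 0ℤ) ≡ (if d then (if c then v else 0ℤ) else 0ℤ)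
  if-swap true  d     = refl
  if-swap false true  = refl
  if-swap false false = refl

maxF-upperBound : ∀ {n} (f : Fin n → ℕ) i → f i ℕ.≤ maxF f
maxF-upperBound f zero    = ℕₚ.m≤m⊔n _ _
maxF-upperBound f (suc i) = ℕₚ.≤-trans (maxF-upperBound (f ∘ suc) i) (ℕₚ.m≤n⊔m _ _)

maxF-least : ∀ {n} (f : Fin n → ℕ) {c} → (∀ i → f i ℕ.≤ c) → maxF f ℕ.≤ c
maxF-least {zero}  f h = z≤n
maxF-least {suc n} f h = ℕₚ.⊔-lub (h zero) (maxF-least (f ∘ suc) (h ∘ suc))

maxF-pullback : ∀ {n m} (π : Fin n → Fin m) → (∀ X → ∃ λ x → π x ≡ X) →
                (f : Fin m → ℕ) (g : Fin n → ℕ) → (∀ x → g x ≡ f (π x)) → maxF f ≡ maxF g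
maxF-pullback π surj f g g≗f∘π = ℕₚ.≤-antisym
  (maxF-least f λ X → let (x , πx≡X) = surj X in
    ℕₚ.≤-trans (ℕₚ.≤-reflexive (trans (cong f (sym πx≡X)) (sym (g≗f∘π x)))) (maxF-upperBound g x))
  (maxF-least g λ x → ℕₚ.≤-trans (ℕₚ.≤-reflexive (g≗f∘π x)) (maxF-upperBound f (π x)))

-- P/∼ is not yet known to be antisymmetric where this is used, so the induction runs
-- along a strictly monotone measure rather than the order itself.
module _ {m} {_⊑_ : Fin m → Fin m → Set} (_⊑?_ : Decidable _⊑_) (⊑-refl : Reflexive _⊑_) where
  open OnFin _⊑_ _⊑?_ using (IsMobius)

  IsMobius-unique : (r : Fin m → ℕ) → (∀ {X Y} → X ⊑ Y → X ≢ Y → r X ℕ.< r Y) →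
                    ∀ {z μ₁ μ₂} → IsMobius z μ₁ → IsMobius z μ₂ → ∀ X → μ₁ X ≡ μ₂ X
  IsMobius-unique r r-mono {z} {μ₁} {μ₂} mob₁ mob₂ X = agree X (<-wellFounded (r X))
    where
    below : (Fin m → ℤ) → Fin m → Fin m → ℤ
    below μ X Y = if ⌊ Y ⊑? X ⌋ then μ Y else 0ℤ

    strictlyBelow : (Fin m → ℤ) → Fin m → ℤ
    strictlyBelow μ X = ∑ (λ Y → if ⌊ X ≟ Y ⌋ then 0ℤ else below μ X Y)

    recursion : ∀ {μ} → IsMobius z μ → ∀ X →
                μ X ℤ.+ strictlyBelow μ X ≡ (if ⌊ z ≟ X ⌋ then 1ℤ else 0ℤ)
    recursion {μ} mob X = begin
      μ X ℤ.+ strictlyBelow μ X         ≡⟨ cong (ℤ._+ strictlyBelow μ X) (sym (if-true (X ⊑? X) ⊑-refl)) ⟩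
      below μ X X ℤ.+ strictlyBelow μ X ≡⟨ sym (∑-split X (below μ X)) ⟩
      ∑ (below μ X)                     ≡⟨ mob X ⟩
      (if ⌊ z ≟ X ⌋ then 1ℤ else 0ℤ)    ∎
      where open ≡-Reasoning

    agree : ∀ X → Acc ℕ._<_ (r X) → μ₁ X ≡ μ₂ X
    agree X (acc rec) = ∙-cancelʳ (strictlyBelow μ₂ X) (μ₁ X) (μ₂ X) (begin
      μ₁ X ℤ.+ strictlyBelow μ₂ X ≡⟨ cong (ℤ._+_ (μ₁ X)) (∑-cong below₁≡below₂) ⟨
      μ₁ X ℤ.+ strictlyBelow μ₁ X ≡⟨ trans (recursion mob₁ X) (sym (recursion mob₂ X)) ⟩
      μ₂ X ℤ.+ strictlyBelow μ₂ X ∎)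
      where
      open ≡-Reasoning
      below₁≡below₂ : ∀ Y → (if ⌊ X ≟ Y ⌋ then 0ℤ else below μ₁ X Y) ≡ (if ⌊ X ≟ Y ⌋ then 0ℤ else below μ₂ X Y)
      below₁≡below₂ Y with X ≟ Y | Y ⊑? X
      ... | yes _   | _      = refl
      ... | no  _   | no _   = refl
      ... | no  X≢Y | yes Y⊑X = agree Y (rec (r-mono Y⊑X (X≢Y ∘ sym)))

module FinitePoset {n} {_≤_ : Fin n → Fin n → Set} (_≤?_ : Decidable _≤_)
                   (isPartialOrder : IsPartialOrder _≡_ _≤_) where
  open OnFin _≤_ _≤?_
  open IsPartialOrder isPartialOrder using (reflexive) renaming (trans to ≤-trans)

  _<?_ : Decidable _<_
  x <? y = (x ≤? y) ×-dec ¬? (x ≟ y)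

  _++_ : ∀ {a b c k l} → SatChain a b k → SatChain b c l → SatChain a c (k + l)
  done       ++ ch = ch
  step a⋖b r ++ ch = step a⋖b (r ++ ch)

  SatChain⇒≤ : ∀ {a b k} → SatChain a b k → a ≤ b
  SatChain⇒≤ done                     = reflexive refl
  SatChain⇒≤ (step ((a≤b , _) , _) r) = ≤-trans a≤b (SatChain⇒≤ r)

  cover-between : ∀ {a b} → Acc _<_ b → a < b → ∃ λ c → a ⋖ c × c ≤ b
  cover-between {a} {b} (acc rec) a<b with any? (λ d → (a <? d) ×-dec (d <? b))
  ... | no ∄d = b , (a<b , λ d a<d<b → ∄d (d , a<d<b)) , reflexive refl
  ... | yes (d , a<d , d<b) =
    let (c , a⋖c , c≤d) = cover-between (rec d<b) a<d in c , a⋖c , ≤-trans c≤d (proj₁ d<b)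

  saturatedChain-acc : ∀ {a b} → Acc (λ x y → y < x) a → a ≤ b → ∃ (SatChain a b)
  saturatedChain-acc {a} {b} (acc rec) a≤b with a ≟ b
  ... | yes refl = 0 , done
  ... | no a≢b =
    let (c , a⋖c , c≤b) = cover-between (po-wellFounded isPartialOrder b) (a≤b , a≢b)
        (k , ch) = saturatedChain-acc (rec (proj₁ a⋖c)) c≤b
    in suc k , step a⋖c ch

  saturatedChain : ∀ {a b} → a ≤ b → ∃ (SatChain a b)
  saturatedChain {a} = saturatedChain-acc (po-noetherian isPartialOrder a)

  module Ranked {z : Fin n} (z-minimum : ∀ x → z ≤ x) {ρ : Fin n → ℕ} (ρ-rank : IsRankFn z ρ) where

    ρ-minimum : ρ z ≡ 0
    ρ-minimum = sym (ρ-rank z 0 done)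

    ρ-++ : ∀ {a b k} → SatChain a b k → ρ b ≡ ρ a + k
    ρ-++ {a} {b} {k} a⇝b =
      let (j , z⇝a) = saturatedChain (z-minimum a)
      in trans (sym (ρ-rank b (j + k) (z⇝a ++ a⇝b))) (cong (_+ k) (ρ-rank a j z⇝a))

    ρ-⋖ : ∀ {a b} → a ⋖ b → ρ b ≡ suc (ρ a)
    ρ-⋖ {a} a⋖b = trans (ρ-++ (step a⋖b done)) (ℕₚ.+-comm (ρ a) 1)

    SatChain⇒< : ∀ {a b k} → SatChain a b (suc k) → a < b
    SatChain⇒< {a} a⇝b = SatChain⇒≤ a⇝b , λ { refl → ℕₚ.m+1+n≢m (ρ a) (sym (ρ-++ a⇝b)) }

    ρ-strictMono : ∀ {a b} → a < b → ρ a ℕ.< ρ b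
    ρ-strictMono {a} {b} (a≤b , a≢b) with saturatedChain a≤b
    ... | zero  , done = ⊥-elim (a≢b refl)
    ... | suc k , a⇝b  = ℕₚ.≤-trans (ℕₚ.m<m+n (ρ a) (ℕ.s≤s z≤n)) (ℕₚ.≤-reflexive (sym (ρ-++ a⇝b)))

module Quotient {n} {_≤_ : Fin n → Fin n → Set} (_≤?_ : Decidable _≤_)
                (isPartialOrder : IsPartialOrder _≡_ _≤_)
                {z : Fin n} (z-minimum : ∀ x → z ≤ x)
                {ρ : Fin n → ℕ} (ρ-rank : OnFin.IsRankFn _≤_ _≤?_ z ρ)
                {m} (π : Fin n → Fin m) (π-surjective : ∀ X → ∃ λ x → π x ≡ X)
                (ρ-fibre : ∀ {x y} → π x ≡ π y → ρ x ≡ ρ y)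
                (homogeneous : ∀ X Y → Quot._≤Q_ _≤_ _≤?_ π X Y →
                               ∀ x → π x ≡ X → ∃ λ y → π y ≡ Y × x ≤ y)
                where
  open OnFin _≤_ _≤?_
  open FinitePoset _≤?_ isPartialOrder
  open Ranked z-minimum ρ-rank
  open Quot _≤_ _≤?_ π
  module Q = OnFin _≤Q_ _≤Q?_
  open IsPartialOrder isPartialOrder using (reflexive)

  rep : Fin m → Fin n
  rep X = proj₁ (π-surjective X)

  π-rep : ∀ X → π (rep X) ≡ X
  π-rep X = proj₂ (π-surjective X)

  ρ̄ : Fin m → ℕ
  ρ̄ X = ρ (rep X)

  ρ̄-π : ∀ {x X} → π x ≡ X → ρ̄ X ≡ ρ x
  ρ̄-π {x} refl = ρ-fibre (π-rep (π x))

  ≤Q-refl : Reflexive _≤Q_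
  ≤Q-refl {X} = rep X , rep X , π-rep X , π-rep X , reflexive refl

  π-<⇒<Q : ∀ {a b} → a < b → π a Q.< π b
  π-<⇒<Q {a} {b} a<b@(a≤b , _) =
    (a , b , refl , refl , a≤b) , λ πa≡πb → ℕₚ.<-irrefl (ρ-fibre πa≡πb) (ρ-strictMono a<b)

  ρ̄-strictMono : ∀ {X Y} → X Q.< Y → ρ̄ X ℕ.< ρ̄ Y
  ρ̄-strictMono {X} {Y} (X≤Y , X≢Y) =
    let (y , πy≡Y , rep≤y) = homogeneous X Y X≤Y (rep X) (π-rep X)
        rep≢y : rep X ≢ y
        rep≢y e = X≢Y (trans (sym (π-rep X)) (trans (cong π e) πy≡Y))
    in ℕₚ.<-≤-trans (ρ-strictMono (rep≤y , rep≢y)) (ℕₚ.≤-reflexive (sym (ρ̄-π πy≡Y)))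

  π-⋖ : ∀ {a b} → a ⋖ b → π a Q.⋖ π b
  π-⋖ {a} {b} a⋖b = π-<⇒<Q (proj₁ a⋖b) , λ W (πa<W , W<πb) →
    ℕₚ.<⇒≱ (ℕₚ.<-≤-trans (ℕₚ.≤-reflexive (cong suc (sym (ρ̄-π refl)))) (ρ̄-strictMono πa<W))
           (ℕₚ.m<1+n⇒m≤n (ℕₚ.<-≤-trans (ρ̄-strictMono W<πb) (ℕₚ.≤-reflexive (trans (ρ̄-π refl) (ρ-⋖ a⋖b)))))

  π-SatChain : ∀ {a b k} → SatChain a b k → Q.SatChain (π a) (π b) k
  π-SatChain done           = Q.done
  π-SatChain (step a⋖b b⇝c) = Q.step (π-⋖ a⋖b) (π-SatChain b⇝c)

  ρ̄-⋖ : ∀ {X Y} → X Q.⋖ Y → ρ̄ Y ≡ suc (ρ̄ X)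
  ρ̄-⋖ {X} {Y} ((X≤Y , X≢Y) , nothing-between) =
    let (y , πy≡Y , rep≤y) = homogeneous X Y X≤Y (rep X) (π-rep X)
    in trans (ρ̄-π πy≡Y) (ρ-along πy≡Y (proj₂ (saturatedChain rep≤y)))
    where
    ρ-along : ∀ {y k} → π y ≡ Y → SatChain (rep X) y k → ρ y ≡ suc (ρ̄ X)
    ρ-along πy≡Y done                  = ⊥-elim (X≢Y (trans (sym (π-rep X)) πy≡Y))
    ρ-along πy≡Y (step x⋖w done)       = ρ-⋖ x⋖w
    ρ-along πy≡Y (step {b = w} x⋖w w⇝y@(step _ _)) = ⊥-elim (nothing-between (π w)
      ( subst (Q._< π w) (π-rep X) (π-<⇒<Q (proj₁ x⋖w))
      , subst (π w Q.<_) πy≡Y (π-<⇒<Q (SatChain⇒< w⇝y))))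

  ρ̄-++ : ∀ {X Y k} → Q.SatChain X Y k → ρ̄ Y ≡ ρ̄ X + k
  ρ̄-++ {X} Q.done                          = sym (ℕₚ.+-identityʳ (ρ̄ X))
  ρ̄-++ {X} (Q.step {k = k} X⋖W W⇝Y) =
    trans (ρ̄-++ W⇝Y) (trans (cong (_+ k) (ρ̄-⋖ X⋖W)) (sym (ℕₚ.+-suc (ρ̄ X) k)))

  ρ̄-isRankFn : Q.IsRankFn (π z) ρ̄
  ρ̄-isRankFn X k Z⇝X = sym (trans (ρ̄-++ Z⇝X) (cong (_+ k) (trans (ρ̄-π refl) ρ-minimum)))

  IsRankFn-π : ∀ {ρQ} → Q.IsRankFn (π z) ρQ → ∀ x → ρQ (π x) ≡ ρ x
  IsRankFn-π ρQ-rank x =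
    let (k , z⇝x) = saturatedChain (z-minimum x)
    in trans (sym (ρQ-rank (π x) k (π-SatChain z⇝x))) (ρ-rank x k z⇝x)

  module _ (z-class : ∀ {x} → π x ≡ π z → x ≡ z)
           {μ : Fin n → ℤ} (μ-mobius : IsMobius z μ)
           (∑-ideal-vanishes : ∀ X → X ≢ π z → ∑ (λ y → if ⌊ InL? X y ⌋ then μ y else 0ℤ) ≡ 0ℤ)
           where

    ≤Q⇔InL : ∀ X y → π y ≤Q X ⇔ InL X y
    ≤Q⇔InL X y = mk⇔ (λ πy≤X → homogeneous (π y) X πy≤X y refl)
                     (λ (x , πx≡X , y≤x) → y , x , refl , πx≡X , y≤x)

    InL-πz⇔≤z : ∀ y → InL (π z) y ⇔ y ≤ z
    InL-πz⇔≤z y = mk⇔ (λ { (x , πx≡πz , y≤x) → subst (y ≤_) (z-class πx≡πz) y≤x })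
                      (λ y≤z → z , refl , y≤z)

    ∑-≤Q-pushforward : ∀ X → ∑ (λ Y → if ⌊ Y ≤Q? X ⌋ then pushforward π μ Y else 0ℤ)
                           ≡ ∑ (λ y → if ⌊ InL? X y ⌋ then μ y else 0ℤ)
    ∑-≤Q-pushforward X = trans (∑-pushforward π μ (λ Y → ⌊ Y ≤Q? X ⌋))
                               (∑-cong (λ y → if-⇔ (≤Q⇔InL X y) (π y ≤Q? X) (InL? X y)))

    pushforward-isMobius : Q.IsMobius (π z) (pushforward π μ)
    pushforward-isMobius X with π z ≟ X
    ... | no πz≢X  = trans (∑-≤Q-pushforward X) (∑-ideal-vanishes X (πz≢X ∘ sym))
    ... | yes refl = begin
      ∑ (λ Y → if ⌊ Y ≤Q? π z ⌋ then pushforward π μ Y else 0ℤ) ≡⟨ ∑-≤Q-pushforward (π z) ⟩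
      ∑ (λ y → if ⌊ InL? (π z) y ⌋ then μ y else 0ℤ)
        ≡⟨ ∑-cong (λ y → if-⇔ (InL-πz⇔≤z y) (InL? (π z) y) (y ≤? z)) ⟩
      ∑ (λ y → if ⌊ y ≤? z ⌋ then μ y else 0ℤ)                   ≡⟨ μ-mobius z ⟩
      (if ⌊ z ≟ z ⌋ then 1ℤ else 0ℤ)                             ≡⟨ if-true (z ≟ z) refl ⟩
      1ℤ                                                          ∎
      where open ≡-Reasoning

    χcoeff-quotient : ∀ {ρQ μQ} → Q.IsRankFn (π z) ρQ → Q.IsMobius (π z) μQ →
                      ∀ k → Q.χcoeff ρQ μQ k ≡ χcoeff ρ μ k
    χcoeff-quotient {ρQ} {μQ} ρQ-rank μQ-mobius k = begin
      ∑ (λ X → if ⌊ (maxF ρQ ∸ ρQ X) ℕ.≟ k ⌋ then μQ X else 0ℤ)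
        ≡⟨ ∑-cong (λ X → cong₂ (λ r v → if ⌊ (r ∸ ρQ X) ℕ.≟ k ⌋ then v else 0ℤ) rankOf-equal (μQ≡ν X)) ⟩
      ∑ (λ X → if ⌊ (maxF ρ ∸ ρQ X) ℕ.≟ k ⌋ then pushforward π μ X else 0ℤ)
        ≡⟨ ∑-pushforward π μ (λ X → ⌊ (maxF ρ ∸ ρQ X) ℕ.≟ k ⌋) ⟩
      ∑ (λ x → if ⌊ (maxF ρ ∸ ρQ (π x)) ℕ.≟ k ⌋ then μ x else 0ℤ)
        ≡⟨ ∑-cong (λ x → cong (λ r → if ⌊ (maxF ρ ∸ r) ℕ.≟ k ⌋ then μ x else 0ℤ) (IsRankFn-π ρQ-rank x)) ⟩
      ∑ (λ x → if ⌊ (maxF ρ ∸ ρ x) ℕ.≟ k ⌋ then μ x else 0ℤ) ∎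
      where
      open ≡-Reasoning
      rankOf-equal : maxF ρQ ≡ maxF ρ
      rankOf-equal = maxF-pullback π π-surjective ρQ ρ (sym ∘ IsRankFn-π ρQ-rank)
      μQ≡ν : ∀ X → μQ X ≡ pushforward π μ X
      μQ≡ν = IsMobius-unique _≤Q?_ ≤Q-refl ρ̄ (λ X≤Y X≢Y → ρ̄-strictMono (X≤Y , X≢Y))
                             μQ-mobius pushforward-isMobius

corollary2p6 :
    ∀ (n : ℕ) (_≤_ : Fin n → Fin n → Set) (_≤?_ : Decidable _≤_) →
    IsPartialOrder _≡_ _≤_ →
    ∀ (z : Fin n) → (∀ x → z ≤ x) →
    ∀ (ρ : Fin n → ℕ) → OnFin.IsRankFn _≤_ _≤?_ z ρ →
    ∀ (μ : Fin n → ℤ) → OnFin.IsMobius _≤_ _≤?_ z μ →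
    ∀ (_∼_ : Fin n → Fin n → Set) → IsEquivalence _∼_ →
    ∀ (m : ℕ) (π : Fin n → Fin m) →
    (∀ X → ∃ λ x → π x ≡ X) →
    (∀ x y → (π x ≡ π y) ⇔ (x ∼ y)) →
    (∀ x → x ∼ z → x ≡ z) →
    (∀ X Y → Quot._≤Q_ _≤_ _≤?_ π X Y →
       ∀ x → π x ≡ X → ∃ λ y → π y ≡ Y × x ≤ y) →
    (∀ X → X ≢ π z →
       ∑ (λ y → if ⌊ Quot.InL? _≤_ _≤?_ π X y ⌋ then μ y else 0ℤ) ≡ 0ℤ) →
    (∀ x y → x ∼ y → ρ x ≡ ρ y) →
    (∃ λ ρQ → OnFin.IsRankFn (Quot._≤Q_ _≤_ _≤?_ π) (Quot._≤Q?_ _≤_ _≤?_ π) (π z) ρQ)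
    × (∀ (ρQ : Fin m → ℕ) →
         OnFin.IsRankFn (Quot._≤Q_ _≤_ _≤?_ π) (Quot._≤Q?_ _≤_ _≤?_ π) (π z) ρQ →
       ∀ (μQ : Fin m → ℤ) →
         OnFin.IsMobius (Quot._≤Q_ _≤_ _≤?_ π) (Quot._≤Q?_ _≤_ _≤?_ π) (π z) μQ →
       ∀ (k : ℕ) →
         OnFin.χcoeff (Quot._≤Q_ _≤_ _≤?_ π) (Quot._≤Q?_ _≤_ _≤?_ π) ρQ μQ k
           ≡ OnFin.χcoeff _≤_ _≤?_ ρ μ k)
corollary2p6 n _≤_ _≤?_ isPartialOrder z z-minimum ρ ρ-rank μ μ-mobius _∼_ _ m π π-surjective
             π≡⇔∼ z-class homogeneous ∑-ideal-vanishes ρ-class =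
  (ρ̄ , ρ̄-isRankFn) ,
  λ ρQ ρQ-rank μQ μQ-mobius → χcoeff-quotient z-class′ μ-mobius ∑-ideal-vanishes ρQ-rank μQ-mobius
  where
  ∼-from-π : ∀ {x y} → π x ≡ π y → x ∼ y
  ∼-from-π {x} {y} = Equivalence.to (π≡⇔∼ x y)

  open Quotient _≤?_ isPartialOrder z-minimum ρ-rank π π-surjective
                (λ {x} {y} → ρ-class x y ∘ ∼-from-π) homogeneous

  z-class′ : ∀ {x} → π x ≡ π z → x ≡ z
  z-class′ {x} = z-class x ∘ ∼-from-π
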